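{- Let $D\ge2$, let $\mathcal{M}_p$ be an edge-colored map with $p$ cilia, and let $\mathcal{M}_0$ be obtained from $\mathcal{M}_p$ by removing the cilia and merging their incident corners. Let $\mathcal{B}=\partial\mathcal{M}_p$ be the boundary graph, $\Omega$ the pairing of $\mathcal{B}$ induced by $\mathcal{M}_p$, and $\mathcal{B}^\Omega$ the corresponding covering. Then $$\delta(\mathcal{M}_p)=\delta(\mathcal{M}_0)-\mathcal{F}(\mathcal{B}^\Omega).$$
   Context: Write $[D]=\{1,\dots,D\}$. An edge-colored map is a connected combinatorial map whose edges carry colors in $[D]$ (coloring not necessarily proper). A cilium is a marker placed in a corner of a vertex, at most one per vertex, splitting that corner in two. For $i\in[D]$, the monochromatic submap $\mathcal{M}^{(i)}$ keeps all vertices and cilia but only the edges of color $i$. Going around the boundary of $\mathcal{M}^{(i)}$ (turning clockwise around vertices; formally the cycles of $\alpha^{(i)}\sigma^{(i)}$, $\sigma^{(i)}$ the rotation restricted to half-edges of color $i$ and cilia, $\alpha^{(i)}$ the edge involution fixing cilia) gives cyclic sequences; those with no cilium are the (closed) faces of color $i$ (an isolated unciliated vertex gives one face), while those containing cilia are cut at each cilium into broken faces of color $i$, oriented walks from one cilium to the next (possibly the same); a broken face is trivial if it traverses no edge. The power of a map $\mathcal{M}$ with cilia is $\delta(\mathcal{M})=\mathcal{F}(\mathcal{M})-(D-1)\mathcal{E}(\mathcal{M})$, where $\mathcal{F}(\mathcal{M})$ is the total number of closed faces over all colors and $\mathcal{E}(\mathcal{M})$ the number of edges. Boundary graph $\partial\mathcal{M}$: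 for each ciliated vertex $V$ create a white vertex $v$ and black vertex $\bar v$; for each non-trivial broken face of color $i$ from the cilium at $V$ to the cilium at $V'$ add an edge of color $i$ between $v$ and $\bar v'$; then for each $V$ and color $i$ not yet incident to $v$ add an edge of color $i$ between $v$ and $\bar v$. The induced pairing $\Omega$ consists of the pairs $\{v,\bar v\}$. The covering $\mathcal{B}^\Omega$ is obtained from $\mathcal{B}$ by adding an edge of color $0$ between the two vertices of each pair of $\Omega$; $\mathcal{F}(\mathcal{B}^\Omega)$ is the total number, over $i\in[D]$, of cycles of $\mathcal{B}^\Omega$ alternating colors $0$ and $i$. -}

module Defs where

open import Data.Nat using (ℕ; zero; suc; _+_; _*_; _∸_; _≤_; _<_; _≡ᵇ_)
open import Data.Nat.Properties using (_≤?_; _<?_)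
open import Data.Bool using (Bool; true; false; if_then_else_; _∧_; _∨_; not)
open import Data.Fin using (Fin; toℕ) renaming (zero to fzero; suc to fsuc)
open import Data.Fin.Properties using () renaming (_≟_ to _≟F_)
open import Data.Fin.Permutation using (Permutation; Permutation′; _⟨$⟩ʳ_)
open import Data.Product using (Σ; ∃; _×_; _,_)
open import Data.Integer using (ℤ; +_; _-_)
open import Relation.Nullary using (¬_)
open import Relation.Nullary.Decidable using (⌊_⌋)
open import Relation.Binary.PropositionalEquality using (_≡_)
open import Relation.Binary.Construct.Closure.ReflexiveTransitive using (Star)

iter : {A : Set} → ℕ → (A → A) → A → A
iter zero    f x = x
iter (suc k) f x = f (iter k f x)

count : (n : ℕ) → (Fin n → Bool) → ℕ
count zero    P = 0
count (suc n) P = (if P fzero then 1 else 0) + count n (λ x → P (fsuc x))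

sumF : (n : ℕ) → (Fin n → ℕ) → ℕ
sumF zero    f = 0
sumF (suc n) f = f fzero + sumF n (λ x → f (fsuc x))

allBelow : ℕ → (ℕ → Bool) → Bool
allBelow zero    P = true
allBelow (suc n) P = allBelow n P ∧ P n

-- first element of  f x , f (f x) , … (at most `fuel` steps) satisfying P
-- (falls back to the last visited element if none is found)
firstAfter : {A : Set} → ℕ → (A → A) → (A → Bool) → A → A
firstAfter zero       f P x = x
firstAfter (suc fuel) f P x with P (f x)
... | true  = f x
... | false = firstAfter fuel f P (f x)

-- Number of cycles of f restricted to the subset S of Fin n
-- (f is assumed to permute S): a cycle is counted through its
-- element of least index.  Orbits have length ≤ n, so k < n suffices.
cyclesOn : (n : ℕ) → (Fin n → Fin n) → (Fin n → Bool) → ℕ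
cyclesOn n f S = count n (λ h → S h ∧
  allBelow n (λ k → ⌊ toℕ h ≤? toℕ (iter k f h) ⌋))

-- A cilium is modelled, as in the
-- paper's formal description, as an extra element of the rotation
-- system σ fixed by the involution α (it sits in a corner of its vertex,
-- splitting it).  Vertices are Fin nV, explicitly, so that a vertex without
-- any half-edge (an isolated vertex) is possible.

module _ (D : ℕ) where

  record Map : Set where
    field
      nV nH  : ℕ
      σ      : Permutation′ nH
      α      : Fin nH → Fin nH
      α-inv  : ∀ h → α (α h) ≡ h
      vert   : Fin nH → Fin nV
      vert-σ : ∀ h → vert (σ ⟨$⟩ʳ h) ≡ vert h
      vert-cycle : ∀ h h' → vert h ≡ vert h' → ∃ λ k → iter k (σ ⟨$⟩ʳ_) h ≡ h'
      col    : Fin nH → Fin D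
      col-α  : ∀ h → col (α h) ≡ col h
      cilium-unique : ∀ h h' → α h ≡ h → α h' ≡ h' → vert h ≡ vert h' → h ≡ h'
      nonempty  : 1 ≤ nV
      connected : ∀ u w → Star (λ x y → Σ (Fin nH) λ h → (vert h ≡ x) × (vert (α h) ≡ y)) u w

module _ {D : ℕ} (M : Map D) where
  open Map M

  σf : Fin nH → Fin nH
  σf h = σ ⟨$⟩ʳ h

  isCilium : Fin nH → Bool
  isCilium h = ⌊ α h ≟F h ⌋

  nEdges : ℕ
  nEdges = count nH (λ h → not (isCilium h) ∧ ⌊ toℕ h <? toℕ (α h) ⌋)

  inSub : Fin D → Fin nH → Bool
  inSub i h = isCilium h ∨ ⌊ col h ≟F i ⌋

  σSub : Fin D → Fin nH → Fin nH
  σSub i = firstAfter nH σf (inSub i)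

  faceStep : Fin D → Fin nH → Fin nH
  faceStep i h = α (σSub i h)

  isolatedUnciliated : Fin D → Fin nV → Bool
  isolatedUnciliated i u = count nH (λ h → ⌊ vert h ≟F u ⌋ ∧ inSub i h) ≡ᵇ 0

  closedFaces : Fin D → ℕ
  closedFaces i =
      count nH (λ h → inSub i h
        ∧ allBelow nH (λ k → not (isCilium (iter k (faceStep i) h)))
        ∧ allBelow nH (λ k → ⌊ toℕ h ≤? toℕ (iter k (faceStep i) h) ⌋))
    + count nV (isolatedUnciliated i)

  nFaces : ℕ
  nFaces = sumF D closedFaces

  δ : ℤ
  δ = + nFaces - + ((D ∸ 1) * nEdges)

  brokenEnd : Fin D → Fin nH → Fin nH
  brokenEnd i c = firstAfter nH (faceStep i) isCilium c

  trivialBroken : Fin D → Fin nH → Bool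
  trivialBroken i c = ⌊ faceStep i c ≟F c ⌋

-- White vertices v_w and black vertices v̄_w are indexed by the w : Fin nW
-- with isVtx w = true.  The edge of color i at the white vertex v_w goes
-- to the black vertex v̄_(edge i w).

record BipGraph (D : ℕ) : Set where
  field
    nW    : ℕ
    isVtx : Fin nW → Bool
    edge  : Fin D → Fin nW → Fin nW

-- Boundary graph ∂M: one white v and one black v̄ per ciliated vertex
-- (indexed by its cilium); an edge of color i from v to v̄' for every
-- non-trivial broken face of color i from the cilium of V to that of V',
-- and an edge of color i from v to v̄ whenever v has no color i edge yet
-- (i.e. the broken face of color i starting at V is trivial).
boundary : {D : ℕ} → Map D → BipGraph D
boundary M = record
  { nW    = Map.nH M
  ; isVtx = isCilium M
  ; edge  = λ i c → if not (trivialBroken M i c) then brokenEnd M i c else c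
  }

-- Pairings of a bipartite graph: Ω pairs the white vertex v_w with the
-- black vertex v̄_(pair w).  The pairing induced by M: Ω = {{v, v̄}}.
inducedPairing : {D : ℕ} → (B : BipGraph D) → Fin (BipGraph.nW B) → Fin (BipGraph.nW B)
inducedPairing B w = w

-- The covering B^Ω: colors Fin (suc D), color 0 = the pairing edges,
-- color (suc i) = the original color i edges.
-- covZeroBack is the white endpoint of the color-0 edge at a black vertex.
record Covering (D : ℕ) : Set where
  field
    nW          : ℕ
    isVtx       : Fin nW → Bool
    edge        : Fin (suc D) → Fin nW → Fin nW
    covZeroBack : Fin nW → Fin nW

covering : {D : ℕ} → (B : BipGraph D) → (Ω : Fin (BipGraph.nW B) → Fin (BipGraph.nW B)) →
           (Ω⁻¹ : Fin (BipGraph.nW B) → Fin (BipGraph.nW B)) → Covering D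
covering B Ω Ω⁻¹ = record
  { nW = BipGraph.nW B
  ; isVtx = BipGraph.isVtx B
  ; edge = λ { fzero → Ω ; (fsuc i) → BipGraph.edge B i }
  ; covZeroBack = Ω⁻¹
  }

-- F(B^Ω): over i ∈ [D], the number of cycles alternating colors 0 and i.
-- Such a cycle visits white vertices w ↦ (color i edge to black
-- v̄_(edge i w)) ↦ (color 0 edge back to white) ; these are the cycles of
-- this map on white vertices.
coveringFaces : {D : ℕ} → Covering D → ℕ
coveringFaces {D} C = sumF D (λ i →
  cyclesOn nW (λ w → covZeroBack (edge (fsuc i) w)) isVtx)
  where open Covering C

-- M₀ is obtained from M by removing all cilia and merging the two
-- corners around each cilium: the darts of M₀ correspond bijectively to
-- the non-cilium darts of M, vertices correspond bijectively, and the
-- rotation of M₀ is the rotation of M skipping cilia.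
record RemovesCilia {D : ℕ} (M M₀ : Map D) : Set where
  private
    module M  = Map M
    module M₀ = Map M₀
  field
    noCilia   : ∀ e → ¬ (M₀.α e ≡ e)
    ι         : Fin M₀.nH → Fin M.nH
    ι-inj     : ∀ e e' → ι e ≡ ι e' → e ≡ e'
    ι-nonCil  : ∀ e → ¬ (M.α (ι e) ≡ ι e)
    ι-onto    : ∀ h → ¬ (M.α h ≡ h) → ∃ λ e → ι e ≡ h
    vmap      : Permutation M₀.nV M.nV
    ι-vert    : ∀ e → M.vert (ι e) ≡ vmap ⟨$⟩ʳ M₀.vert e
    ι-α       : ∀ e → ι (M₀.α e) ≡ M.α (ι e)
    ι-col     : ∀ e → M.col (ι e) ≡ M₀.col e
    ι-σ       : ∀ e → ι (M₀.σ ⟨$⟩ʳ e) ≡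
                  firstAfter M.nH (σf M) (λ h → not (isCilium M h)) (ι e)

module Submission where

-- Edges are unaffected by removing cilia, so the statement reduces to the
-- face identity  F(M₀) = F(Mₚ) + F(B^Ω), which is proved color by color.
-- Fix a color i and let f = α⁽ⁱ⁾σ⁽ⁱ⁾ be the face permutation of Mₚ on the
-- darts S of color i together with the cilia.  Every cycle of f either
-- avoids the cilia (a closed face of Mₚ) or meets them; the latter
-- correspond to the cycles of the first-return map of f to the cilia,
-- which is exactly the color-(0,i) cycle structure of B^Ω.  Sorting the
-- same cycles instead by whether they meet the genuine half-edges A ⊆ S:
-- those that do are, via first return to A, the closed faces of M₀; those
-- that do not are fixed cilia whose vertex carries no color-i edge, and
-- these are precisely the vertices that become isolated in color i once
-- their cilium is removed.

open import Defs
open import Data.Nat using (ℕ; zero; suc; _+_; _*_; _∸_; _≤_; _<_; _≡ᵇ_; z≤n; s≤s; _≤?_; _<?_)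
open import Data.Nat.Properties
  using ( +-suc; +-comm; +-identityʳ; *-suc; ≤-refl; ≤-trans; ≤-antisym; ≤-pred; ≤-reflexive
        ; ≤-<-trans; <-≤-trans; <-cmp; <-asym; m≤n+m; m≤n⇒m≤1+n; m≤n⇒m<n∨m≡n; m≤n⇒∃[o]m+o≡n
        ; ≮⇒≥; ≰⇒>; ≤∧≢⇒<; +-cancelʳ-<; *-cancelˡ-≡; ≡ᵇ⇒≡; +-commutativeSemigroup )
open import Data.Nat.DivMod using (_%_; _/_; m≡m%n+[m/n]*n; m%n<n)
open import Data.Bool using (Bool; true; false; if_then_else_; _∧_; not; T)
open import Data.Bool.Properties using (∧-comm; ∧-assoc; ∧-identityʳ; not-involutive)
open import Data.Fin using (Fin; toℕ) renaming (zero to fzero; suc to fsuc)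
open import Data.Fin.Properties using (toℕ-injective; toℕ<n; pigeonhole) renaming (_≟_ to _≟F_; suc-injective to fsuc-injective)
open import Data.Fin.Permutation using (Permutation; _⟨$⟩ʳ_; _⟨$⟩ˡ_; inverseˡ; inverseʳ)
open import Data.Product using (Σ; ∃; _×_; _,_; proj₁; proj₂)
open import Data.Sum using (inj₁; inj₂)
open import Data.Empty using (⊥; ⊥-elim)
open import Relation.Nullary using (¬_; Dec; yes; no)
open import Relation.Nullary.Decidable using (⌊_⌋)
open import Relation.Binary.Definitions using (tri<; tri≈; tri>)
open import Relation.Binary.PropositionalEquality
open import Function using (_∘_)
open import Algebra.Properties.CommutativeSemigroup +-commutativeSemigroup
  using (xy∙z≈zx∙y; xy∙z≈x∙zy) renaming (interchange to +-interchange)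

∧-elim : ∀ {a b} → a ∧ b ≡ true → (a ≡ true) × (b ≡ true)
∧-elim {true} {true} _ = refl , refl

∧-intro : ∀ {a b} → a ≡ true → b ≡ true → a ∧ b ≡ true
∧-intro refl refl = refl

not-true : ∀ {a} → not a ≡ true → a ≡ false
not-true {false} _ = refl

not-false : ∀ {a} → a ≡ false → not a ≡ true
not-false refl = refl

not≡false : ∀ {a} → not a ≡ false → a ≡ true
not≡false {true} _ = refl

∧-false : ∀ {a b} → a ≡ true → a ∧ b ≡ false → b ≡ false
∧-false refl e = e

true≢false : ∀ {a} → a ≡ true → a ≡ false → ⊥
true≢false refl ()

bool-ext : ∀ {a b} → (a ≡ true → b ≡ true) → (b ≡ true → a ≡ true) → a ≡ b
bool-ext {false} {false} _ _ = refl
bool-ext {false} {true}  _ g = g refl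
bool-ext {true}  {false} f _ = sym (f refl)
bool-ext {true}  {true}  _ _ = refl

⊆-false : ∀ {A : Set} (P Q : A → Bool) → (∀ z → Q z ≡ true → P z ≡ true) → ∀ z → P z ≡ false → Q z ≡ false
⊆-false P Q Q⊆P z pz with Q z in eq
... | false = refl
... | true  = ⊥-elim (true≢false (Q⊆P z eq) pz)

⌊⌋-yes : ∀ {A : Set} (d : Dec A) → A → ⌊ d ⌋ ≡ true
⌊⌋-yes (yes _) _ = refl
⌊⌋-yes (no ¬a) a = ⊥-elim (¬a a)

⌊⌋-no : ∀ {A : Set} (d : Dec A) → ¬ A → ⌊ d ⌋ ≡ false
⌊⌋-no (yes a) ¬a = ⊥-elim (¬a a)
⌊⌋-no (no _)  _  = refl

⌊⌋-true : ∀ {A : Set} (d : Dec A) → ⌊ d ⌋ ≡ true → A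
⌊⌋-true (yes a) _ = a

iter-add : ∀ {A : Set} a b (f : A → A) x → iter (a + b) f x ≡ iter a f (iter b f x)
iter-add zero    b f x = refl
iter-add (suc a) b f x = cong f (iter-add a b f x)

iter-shift : ∀ {A : Set} k (f : A → A) x → iter k f (f x) ≡ iter (suc k) f x
iter-shift zero    f x = refl
iter-shift (suc k) f x = cong f (iter-shift k f x)

iter-fix : ∀ {A : Set} (f : A → A) x → f x ≡ x → ∀ k → iter k f x ≡ x
iter-fix f x e zero    = refl
iter-fix f x e (suc k) = trans (cong f (iter-fix f x e k)) e

iter-periodic : ∀ {A : Set} m p (f : A → A) x → iter p f x ≡ x → iter (m * p) f x ≡ x
iter-periodic zero    p f x e = refl
iter-periodic (suc m) p f x e =
  trans (iter-add p (m * p) f x) (trans (cong (iter p f) (iter-periodic m p f x e)) e)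

iter-pres : ∀ {A : Set} (f : A → A) (D : A → Set) → (∀ x → D x → D (f x)) → ∀ k x → D x → D (iter k f x)
iter-pres f D p zero    x d = d
iter-pres f D p (suc k) x d = p _ (iter-pres f D p k x d)

iter-conj : ∀ {A B : Set} (φ : A → B) (g : A → A) (G : B → B) (D : A → Set) →
  (∀ x → D x → D (g x)) → (∀ x → D x → φ (g x) ≡ G (φ x)) →
  ∀ k x → D x → φ (iter k g x) ≡ iter k G (φ x)
iter-conj φ g G D Dg c zero    x d = refl
iter-conj φ g G D Dg c (suc k) x d =
  trans (c _ (iter-pres g D Dg k x d)) (cong G (iter-conj φ g G D Dg c k x d))

count-cong : ∀ n (P Q : Fin n → Bool) → (∀ x → P x ≡ Q x) → count n P ≡ count n Q
count-cong zero    P Q e = refl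
count-cong (suc n) P Q e rewrite e fzero = cong ((if Q fzero then 1 else 0) +_) (count-cong n _ _ (e ∘ fsuc))

count-split : ∀ n (P Q : Fin n → Bool) →
  count n P ≡ count n (λ x → P x ∧ Q x) + count n (λ x → P x ∧ not (Q x))
count-split zero    P Q = refl
count-split (suc n) P Q with P fzero | Q fzero | count-split n (P ∘ fsuc) (Q ∘ fsuc)
... | false | false | ih = ih
... | false | true  | ih = ih
... | true  | false | ih = trans (cong suc ih) (sym (+-suc _ _))
... | true  | true  | ih = cong suc ih

count-zero : ∀ n (P : Fin n → Bool) → (∀ x → P x ≡ false) → count n P ≡ 0
count-zero zero    P h = refl
count-zero (suc n) P h rewrite h fzero = count-zero n (P ∘ fsuc) (h ∘ fsuc)

count-zero⇒ : ∀ n (P : Fin n → Bool) → count n P ≡ 0 → ∀ x → P x ≡ false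
count-zero⇒ (suc n) P e x with P fzero in eq
count-zero⇒ (suc n) P e fzero    | false = eq
count-zero⇒ (suc n) P e (fsuc x) | false = count-zero⇒ n (P ∘ fsuc) e x

count-witness : ∀ n (P : Fin n → Bool) → (count n P ≡ᵇ 0) ≡ false → Σ (Fin n) λ x → P x ≡ true
count-witness (suc n) P e with P fzero in eq
... | true  = fzero , eq
... | false with count-witness n (P ∘ fsuc) e
...   | x , p = fsuc x , p

count-remove : ∀ m (Q Q' : Fin m → Bool) (y₀ : Fin m) → Q y₀ ≡ true → Q' y₀ ≡ false →
  (∀ y → ¬ y ≡ y₀ → Q' y ≡ Q y) → count m Q ≡ suc (count m Q')
count-remove (suc m) Q Q' fzero q q' o rewrite q | q' =
  cong suc (count-cong m _ _ (λ y → sym (o (fsuc y) λ ())))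
count-remove (suc m) Q Q' (fsuc y₀) q q' o rewrite o fzero (λ ()) =
  trans (cong ((if Q fzero then 1 else 0) +_) (count-remove m (Q ∘ fsuc) (Q' ∘ fsuc) y₀ q q' (λ y ne → o (fsuc y) (ne ∘ fsuc-injective))))
        (+-suc _ _)

count-inj : ∀ n m (P : Fin n → Bool) (Q : Fin m → Bool) (g : (x : Fin n) → P x ≡ true → Fin m) →
  (∀ x p → Q (g x p) ≡ true) → (∀ x y p q → g x p ≡ g y q → x ≡ y) → count n P ≤ count m Q
count-inj zero m P Q g gQ gi = z≤n
count-inj (suc n) m P Q g gQ gi with P fzero in eq
... | false = count-inj n m (P ∘ fsuc) Q (g ∘ fsuc) (gQ ∘ fsuc) (λ x y p q e → fsuc-injective (gi _ _ p q e))
... | true  = subst (suc (count n (P ∘ fsuc)) ≤_) (sym (count-remove m Q Q' y₀ (gQ fzero eq) Q'y₀ Q'-other))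
                (s≤s (count-inj n m (P ∘ fsuc) Q' (g ∘ fsuc) gQ' (λ x y p q e → fsuc-injective (gi _ _ p q e))))
  where
  y₀ = g fzero eq
  Q' : Fin m → Bool
  Q' y = Q y ∧ not ⌊ y ≟F y₀ ⌋
  Q'y₀ : Q' y₀ ≡ false
  Q'y₀ rewrite ⌊⌋-yes (y₀ ≟F y₀) refl = ∧-comm (Q y₀) false
  Q'-other : ∀ y → ¬ y ≡ y₀ → Q' y ≡ Q y
  Q'-other y ne rewrite ⌊⌋-no (y ≟F y₀) ne = ∧-identityʳ (Q y)
  gQ' : ∀ x p → Q' (g (fsuc x) p) ≡ true
  gQ' x p = ∧-intro (gQ (fsuc x) p) (not-false (⌊⌋-no (_ ≟F y₀) (λ e → fsuc≢fzero (gi _ _ p eq e))))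
    where
    fsuc≢fzero : ¬ fsuc x ≡ fzero
    fsuc≢fzero ()

count-bij : ∀ n m (P : Fin n → Bool) (Q : Fin m → Bool)
  (g : (x : Fin n) → P x ≡ true → Fin m) → (∀ x p → Q (g x p) ≡ true) → (∀ x y p q → g x p ≡ g y q → x ≡ y) →
  (h : (y : Fin m) → Q y ≡ true → Fin n) → (∀ y q → P (h y q) ≡ true) → (∀ x y p q → h x p ≡ h y q → x ≡ y) →
  count n P ≡ count m Q
count-bij n m P Q g gQ gi h hP hi = ≤-antisym (count-inj n m P Q g gQ gi) (count-inj m n Q P h hP hi)

noneAt : ∀ n {m} → (Fin n → Fin m) → (Fin n → Bool) → Fin m → Bool
noneAt n vert Q v = count n (λ h → ⌊ vert h ≟F v ⌋ ∧ Q h) ≡ᵇ 0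

noneAt-spec : ∀ n {m} (vert : Fin n → Fin m) Q v → noneAt n vert Q v ≡ true → ∀ h → vert h ≡ v → Q h ≡ false
noneAt-spec n vert Q v e h vh with count-zero⇒ n _ (≡ᵇ⇒≡ _ 0 (subst T (sym e) _)) h
... | p rewrite ⌊⌋-yes (vert h ≟F v) vh = p

noneAt-intro : ∀ n {m} (vert : Fin n → Fin m) Q v → (∀ h → vert h ≡ v → Q h ≡ false) → noneAt n vert Q v ≡ true
noneAt-intro n vert Q v H = cong (_≡ᵇ 0) (count-zero n _ none)
  where
  none : ∀ h → ⌊ vert h ≟F v ⌋ ∧ Q h ≡ false
  none h with vert h ≟F v
  ... | yes e = H h e
  ... | no _  = refl

noneAt-witness : ∀ n {m} (vert : Fin n → Fin m) Q v → noneAt n vert Q v ≡ false →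
  Σ (Fin n) λ h → (vert h ≡ v) × (Q h ≡ true)
noneAt-witness n vert Q v e with count-witness n _ e
... | h , p with vert h ≟F v
...   | yes vh = h , vh , p

sumF-cong : ∀ n (f g : Fin n → ℕ) → (∀ i → f i ≡ g i) → sumF n f ≡ sumF n g
sumF-cong zero    f g e = refl
sumF-cong (suc n) f g e = cong₂ _+_ (e fzero) (sumF-cong n _ _ (e ∘ fsuc))

sumF-+ : ∀ n (f g : Fin n → ℕ) → sumF n (λ i → f i + g i) ≡ sumF n f + sumF n g
sumF-+ zero    f g = refl
sumF-+ (suc n) f g rewrite sumF-+ n (f ∘ fsuc) (g ∘ fsuc) =
  +-interchange (f fzero) (g fzero) (sumF n (f ∘ fsuc)) (sumF n (g ∘ fsuc))

allBelow-true : ∀ n P → allBelow n P ≡ true → ∀ k → k < n → P k ≡ true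
allBelow-true (suc n) P e k k<n with ∧-elim {allBelow n P} e | m≤n⇒m<n∨m≡n (≤-pred k<n)
... | below , _ | inj₁ k<n' = allBelow-true n P below k k<n'
... | _ , last  | inj₂ refl = last

allBelow-intro : ∀ n P → (∀ k → k < n → P k ≡ true) → allBelow n P ≡ true
allBelow-intro zero    P h = refl
allBelow-intro (suc n) P h = ∧-intro (allBelow-intro n P (λ k lt → h k (m≤n⇒m≤1+n lt))) (h n ≤-refl)

allBelow-false : ∀ n P → allBelow n P ≡ false → ∃ λ k → k < n × P k ≡ false
allBelow-false (suc n) P e with allBelow n P in below | P n in last
... | false | _ with allBelow-false n P below
...   | k , lt , pk = k , m≤n⇒m≤1+n lt , pk
allBelow-false (suc n) P e | true | false = n , ≤-refl , last

allBelow-cong : ∀ n (F G : ℕ → Bool) → (∀ k → F k ≡ G k) → allBelow n F ≡ allBelow n G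
allBelow-cong zero    F G e = refl
allBelow-cong (suc n) F G e = cong₂ _∧_ (allBelow-cong n F G e) (e n)

FirstHit : {A : Set} (f : A → A) (P : A → Bool) (x y : A) (k : ℕ) → Set
FirstHit f P x y k = (y ≡ iter (suc k) f x) × (P y ≡ true) × (∀ j → j < k → P (iter (suc j) f x) ≡ false)

firstAfter-spec : ∀ {A : Set} fuel (f : A → A) (P : A → Bool) x k → k < fuel → P (iter (suc k) f x) ≡ true →
  ∃ λ k' → k' < fuel × FirstHit f P x (firstAfter fuel f P x) k'
firstAfter-spec (suc fuel) f P x k lt hit with P (f x) in eq
... | true = 0 , s≤s z≤n , refl , eq , (λ j ())
... | false with k
...   | zero = ⊥-elim (true≢false hit eq)
...   | suc k₁ with firstAfter-spec fuel f P (f x) k₁ (≤-pred lt) (trans (cong P (iter-shift (suc k₁) f x)) hit)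
...     | k' , lt' , e , pe , earlier = suc k' , s≤s lt' , trans e (iter-shift (suc k') f x) , pe , earlier'
  where
  earlier' : ∀ j → j < suc k' → P (iter (suc j) f x) ≡ false
  earlier' zero    _       = eq
  earlier' (suc j) (s≤s l) = trans (cong P (sym (iter-shift (suc j) f x))) (earlier j l)

FirstHit-unique : ∀ {A : Set} (f : A → A) (P : A → Bool) x y y' k k' →
  FirstHit f P x y k → FirstHit f P x y' k' → (k ≡ k') × (y ≡ y')
FirstHit-unique f P x y y' k k' (e , p , m) (e' , p' , m') with <-cmp k k'
... | tri< lt _ _  = ⊥-elim (true≢false (subst (λ z → P z ≡ true) e p) (m' k lt))
... | tri> _ _ gt  = ⊥-elim (true≢false (subst (λ z → P z ≡ true) e' p') (m k' gt))
... | tri≈ _ refl _ = refl , trans e (sym e')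

FirstHit-weaken : ∀ {A : Set} (f : A → A) (P Q : A → Bool) x y k → (∀ z → Q z ≡ true → P z ≡ true) → Q y ≡ true →
  FirstHit f P x y k → FirstHit f Q x y k
FirstHit-weaken f P Q x y k Q⊆P qy (e , _ , m) = e , qy , λ j lt → ⊆-false P Q Q⊆P _ (m j lt)

FirstHit-shift : ∀ {A : Set} (f : A → A) (P : A → Bool) x y k →
  FirstHit f P x y (suc k) → FirstHit f P (f x) y k × P (f x) ≡ false
FirstHit-shift f P x y k (e , p , m) =
  (trans e (sym (iter-shift (suc k) f x)) , p , λ j lt → trans (cong P (iter-shift (suc j) f x)) (m (suc j) (s≤s lt)))
  , m 0 (s≤s z≤n)

FirstHit-glue : ∀ {A : Set} (f : A → A) (P : A → Bool) x y z k k₂ → y ≡ iter (suc k) f x →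
  (∀ j → j < k → P (iter (suc j) f x) ≡ false) → P y ≡ false → FirstHit f P y z k₂ → FirstHit f P x z (k₂ + suc k)
FirstHit-glue f P x y z k k₂ ey my py (ez , pz , mz) =
  trans ez (trans (cong (iter (suc k₂) f) ey) (sym (iter-add (suc k₂) (suc k) f x))) , pz , earlier
  where
  earlier : ∀ j → j < k₂ + suc k → P (iter (suc j) f x) ≡ false
  earlier j lt with <-cmp j k
  ... | tri< j<k _ _  = my j j<k
  ... | tri≈ _ refl _ = trans (cong P (sym ey)) py
  ... | tri> _ _ k<j with m≤n⇒∃[o]m+o≡n k<j
  ...   | d , deq = trans (cong P (trans (cong (λ w → iter (suc w) f x) (sym j≡d+k))
                       (trans (iter-add (suc d) (suc k) f x) (cong (iter (suc d) f) (sym ey)))))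
                     (mz d (+-cancelʳ-< (suc k) d k₂ (subst (_< k₂ + suc k) (sym j≡d+k) lt)))
    where
    j≡d+k : d + suc k ≡ j
    j≡d+k = trans (+-suc d k) (trans (cong suc (+-comm d k)) deq)

-- Partial permutations: f permutes the subset S of Fin n, i.e. maps S
-- into S injectively (hence bijectively, S being finite).  cyclesOn n f S
-- counts the cycles of such an f through their least element.

record PermOn (n : ℕ) : Set where
  field
    f    : Fin n → Fin n
    S    : Fin n → Bool
    pres : ∀ x → S x ≡ true → S (f x) ≡ true
    inj  : ∀ x y → S x ≡ true → S y ≡ true → f x ≡ f y → x ≡ y

Orb : ∀ {n} → (Fin n → Fin n) → Fin n → Fin n → Set
Orb f x y = ∃ λ k → iter k f x ≡ y

Orb-refl : ∀ {n} (f : Fin n → Fin n) x → Orb f x x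
Orb-refl f x = 0 , refl

Orb-step : ∀ {n} (f : Fin n → Fin n) x → Orb f x (f x)
Orb-step f x = 1 , refl

Orb-trans : ∀ {n} (f : Fin n → Fin n) {x y z} → Orb f x y → Orb f y z → Orb f x z
Orb-trans f {x} (k₁ , refl) (k₂ , refl) = k₂ + k₁ , iter-add k₂ k₁ f x

-- the orbit of x avoids / meets the set X (its first n points suffice)
avoids : ∀ n → (Fin n → Fin n) → (Fin n → Bool) → Fin n → Bool
avoids n f X x = allBelow n (λ k → not (X (iter k f x)))

meets : ∀ n → (Fin n → Fin n) → (Fin n → Bool) → Fin n → Bool
meets n f X x = not (avoids n f X x)

-- Orbit theory of a partial permutation on a finite set.
module Orbits {n} (P : PermOn n) where
  open PermOn P

  iter-S : ∀ k x → S x ≡ true → S (iter k f x) ≡ true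
  iter-S = iter-pres f (λ z → S z ≡ true) pres

  iter-cancel : ∀ k x y → S x ≡ true → S y ≡ true → iter k f x ≡ iter k f y → x ≡ y
  iter-cancel zero    x y sx sy e = e
  iter-cancel (suc k) x y sx sy e = iter-cancel k x y sx sy (inj _ _ (iter-S k x sx) (iter-S k y sy) e)

  period : ∀ x → S x ≡ true → ∃ λ q → q < n × iter (suc q) f x ≡ x
  period x sx with pigeonhole ≤-refl (λ (i : Fin (suc n)) → iter (toℕ i) f x)
  ... | i , j , i<j , e with m≤n⇒∃[o]m+o≡n i<j
  ...   | d , i+d≡j = d , d<n , sym (iter-cancel (toℕ i) x _ sx (iter-S (suc d) x sx) shifted)
    where
    shifted : iter (toℕ i) f x ≡ iter (toℕ i) f (iter (suc d) f x)
    shifted = trans e (trans (cong (λ m → iter m f x) (sym (trans (+-suc (toℕ i) d) i+d≡j)))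
                             (iter-add (toℕ i) (suc d) f x))
    d<n : d < n
    d<n = ≤-<-trans (m≤n+m d (toℕ i)) (≤-pred (subst (_< suc n) (sym i+d≡j) (toℕ<n j)))

  Orb-S : ∀ x y → S x ≡ true → Orb f x y → S y ≡ true
  Orb-S x y sx (k , refl) = iter-S k x sx

  Orb-sym : ∀ x y → S x ≡ true → Orb f x y → Orb f y x
  Orb-sym x y sx (k , refl) with period x sx
  ... | q , _ , per = k * q , trans (sym (iter-add (k * q) k f x))
        (trans (cong (λ m → iter m f x) (trans (+-comm (k * q) k) (sym (*-suc k q))))
               (iter-periodic k (suc q) f x per))

  Orb-bounded : ∀ x y → S x ≡ true → Orb f x y → ∃ λ j → j < n × iter j f x ≡ y
  Orb-bounded x y sx (k , refl) with period x sx
  ... | q , q<n , per = k % suc q , <-≤-trans (m%n<n k (suc q)) q<n , reduced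
    where
    reduced : iter (k % suc q) f x ≡ iter k f x
    reduced = begin
        iter (k % suc q) f x
      ≡⟨ cong (iter (k % suc q) f) (sym (iter-periodic (k / suc q) (suc q) f x per)) ⟩
        iter (k % suc q) f (iter ((k / suc q) * suc q) f x)
      ≡⟨ sym (iter-add (k % suc q) _ f x) ⟩
        iter (k % suc q + (k / suc q) * suc q) f x
      ≡⟨ cong (λ m → iter m f x) (sym (m≡m%n+[m/n]*n k (suc q))) ⟩
        iter k f x
      ∎
      where open ≡-Reasoning

  avoids-spec : ∀ X x → S x ≡ true → avoids n f X x ≡ true → ∀ y → Orb f x y → X y ≡ false
  avoids-spec X x sx a y o with Orb-bounded x y sx o
  ... | j , j<n , refl = not-true (allBelow-true n _ a j j<n)

  avoids-intro : ∀ X x → (∀ y → Orb f x y → X y ≡ false) → avoids n f X x ≡ true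
  avoids-intro X x h = allBelow-intro n _ (λ k _ → not-false (h _ (k , refl)))

  avoids-false : ∀ X x → avoids n f X x ≡ false → ∃ λ y → Orb f x y × X y ≡ true
  avoids-false X x e with allBelow-false n _ e
  ... | k , _ , pk = iter k f x , (k , refl) , not≡false pk

  meets-inv : ∀ X x → S x ≡ true → meets n f X x ≡ true → meets n f X (f x) ≡ true
  meets-inv X x sx m with avoids n f X (f x) in eq
  ... | false = refl
  ... | true  = ⊥-elim (true≢false (avoids-intro X x (λ y o → avoids-spec X (f x) (pres x sx) eq y
                  (Orb-trans f (Orb-sym x (f x) sx (Orb-step f x)) o))) (not-true m))

  -- isMin x: x is the least element of its cycle; cyclesOn n f S counts these
  isMin : Fin n → Bool
  isMin x = S x ∧ allBelow n (λ k → ⌊ toℕ x ≤? toℕ (iter k f x) ⌋)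

  isMin-spec : ∀ x → isMin x ≡ true → (S x ≡ true) × (∀ y → Orb f x y → toℕ x ≤ toℕ y)
  isMin-spec x e with ∧-elim {S x} e
  ... | sx , least = sx , below
    where
    below : ∀ y → Orb f x y → toℕ x ≤ toℕ y
    below y o with Orb-bounded x y sx o
    ... | j , j<n , refl = ⌊⌋-true (_ ≤? _) (allBelow-true n _ least j j<n)

  min-exists : ∀ x → S x ≡ true → ∃ λ m → Orb f x m × isMin m ≡ true
  min-exists x sx = descend (suc (toℕ x)) x ≤-refl (Orb-refl f x)
    where
    -- walk to strictly smaller orbit points until a minimum is found
    descend : ∀ b y → toℕ y < b → Orb f x y → ∃ λ m → Orb f x m × isMin m ≡ true
    descend (suc b) y y<b o with isMin y in eq
    ... | true = y , o , eq
    ... | false with allBelow-false n _ (∧-false (Orb-S x y sx o) eq)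
    ...   | k , _ , smaller = descend b (iter k f y)
              (≤-trans (≰⇒> (λ le → true≢false (⌊⌋-yes (_ ≤? _) le) smaller)) (≤-pred y<b))
              (Orb-trans f o (k , refl))

  min-unique : ∀ m m' → isMin m ≡ true → isMin m' ≡ true → Orb f m m' → m ≡ m'
  min-unique m m' im im' o with isMin-spec m im | isMin-spec m' im'
  ... | sm , least | _ , least' = toℕ-injective (≤-antisym (least m' o) (least' m (Orb-sym m m' sm o)))

  minOf : ∀ x → S x ≡ true → Fin n
  minOf x sx = proj₁ (min-exists x sx)

  minOf-orb : ∀ x sx → Orb f x (minOf x sx)
  minOf-orb x sx = proj₁ (proj₂ (min-exists x sx))

  minOf-min : ∀ x sx → isMin (minOf x sx) ≡ true
  minOf-min x sx = proj₂ (proj₂ (min-exists x sx))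

  minOf-≡ : ∀ x y sx sy → minOf x sx ≡ minOf y sy → Orb f x y
  minOf-≡ x y sx sy e =
    Orb-trans f (minOf-orb x sx) (subst (λ z → Orb f z y) (sym e) (Orb-sym y _ sy (minOf-orb y sy)))

-- A map between the domains of two partial permutations that preserves and
-- reflects "lying on a common cycle" and reaches every cycle induces a
-- bijection between their cycles.
record CycleMatch {n m} (P₁ : PermOn n) (P₂ : PermOn m) : Set where
  field
    φ        : Fin n → Fin m
    φ-S      : ∀ x → PermOn.S P₁ x ≡ true → PermOn.S P₂ (φ x) ≡ true
    φ-orb    : ∀ x y → PermOn.S P₁ x ≡ true → PermOn.S P₁ y ≡ true →
               Orb (PermOn.f P₁) x y → Orb (PermOn.f P₂) (φ x) (φ y)
    φ-orb⁻¹  : ∀ x y → PermOn.S P₁ x ≡ true → PermOn.S P₁ y ≡ true →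
               Orb (PermOn.f P₂) (φ x) (φ y) → Orb (PermOn.f P₁) x y
    φ-onto   : ∀ t → PermOn.S P₂ t ≡ true → Σ (Fin n) λ x → (PermOn.S P₁ x ≡ true) × Orb (PermOn.f P₂) (φ x) t

cycles-transfer : ∀ {n m} {P₁ : PermOn n} {P₂ : PermOn m} → CycleMatch P₁ P₂ →
  cyclesOn n (PermOn.f P₁) (PermOn.S P₁) ≡ cyclesOn m (PermOn.f P₂) (PermOn.S P₂)
cycles-transfer {n} {m} {P₁} {P₂} C =
  count-bij n m A.isMin B.isMin g (λ _ _ → B.minOf-min _ _) g-inj h (λ _ _ → A.minOf-min _ _) h-inj
  where
  module A = Orbits P₁
  module B = Orbits P₂
  open CycleMatch C

  g : (x : Fin n) → A.isMin x ≡ true → Fin m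
  g x p = B.minOf (φ x) (φ-S x (proj₁ (A.isMin-spec x p)))

  g-inj : ∀ x y p q → g x p ≡ g y q → x ≡ y
  g-inj x y p q e = A.min-unique x y p q (φ-orb⁻¹ x y sx sy (B.minOf-≡ _ _ _ _ e))
    where
    sx = proj₁ (A.isMin-spec x p)
    sy = proj₁ (A.isMin-spec y q)

  preimage : (t : Fin m) → B.isMin t ≡ true → Σ (Fin n) λ x → (PermOn.S P₁ x ≡ true) × Orb (PermOn.f P₂) (φ x) t
  preimage t q = φ-onto t (proj₁ (B.isMin-spec t q))

  h : (t : Fin m) → B.isMin t ≡ true → Fin n
  h t q = A.minOf (proj₁ (preimage t q)) (proj₁ (proj₂ (preimage t q)))

  h-inj : ∀ t u p q → h t p ≡ h u q → t ≡ u
  h-inj t u p q e with preimage t p | preimage u q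
  ... | xt , sxt , ot | xu , sxu , ou = B.min-unique t u p q
        (Orb-trans (PermOn.f P₂) (B.Orb-sym (φ xt) t (φ-S xt sxt) ot)
          (Orb-trans (PermOn.f P₂) (φ-orb xt xu sxt sxu (A.minOf-≡ xt xu sxt sxu e)) ou))

restrict : ∀ {n} (P : PermOn n) (U : Fin n → Bool) →
  (∀ x → PermOn.S P x ≡ true → U x ≡ true → U (PermOn.f P x) ≡ true) → PermOn n
restrict P U U-inv = record
  { f    = f
  ; S    = λ x → S x ∧ U x
  ; pres = λ x e → let (sx , ux) = ∧-elim {S x} e in ∧-intro (pres x sx) (U-inv x sx ux)
  ; inj  = λ x y ex ey → inj x y (proj₁ (∧-elim {S x} ex)) (proj₁ (∧-elim {S y} ey))
  }
  where open PermOn P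

cyclesOn-cong : ∀ n (g g' : Fin n → Fin n) (S : Fin n → Bool) → (∀ x → S x ≡ true → g x ≡ g' x) →
  (∀ x → S x ≡ true → S (g' x) ≡ true) → cyclesOn n g S ≡ cyclesOn n g' S
cyclesOn-cong n g g' S e g'-S = count-cong n _ _ pointwise
  where
  pointwise : ∀ h → (S h ∧ allBelow n (λ k → ⌊ toℕ h ≤? toℕ (iter k g h) ⌋))
                  ≡ (S h ∧ allBelow n (λ k → ⌊ toℕ h ≤? toℕ (iter k g' h) ⌋))
  pointwise h with S h in sh
  ... | false = refl
  ... | true  = allBelow-cong n _ _ (λ k → cong (λ w → ⌊ toℕ h ≤? toℕ w ⌋)
                  (iter-conj (λ x → x) g g' (λ x → S x ≡ true)
                     (λ x sx → subst (λ w → S w ≡ true) (sym (e x sx)) (g'-S x sx)) e k h sh))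

cycles-split : ∀ n (g : Fin n → Fin n) (S X : Fin n → Bool) →
  cyclesOn n g S ≡ cyclesOn n g (λ x → S x ∧ meets n g X x) + cyclesOn n g (λ x → S x ∧ avoids n g X x)
cycles-split n g S X =
  trans (count-split n _ (meets n g X))
        (cong₂ _+_ (count-cong n _ _ (λ h → ∧-swap (S h) _ _))
                   (count-cong n _ _ (λ h → trans (∧-swap (S h) _ _) (cong (λ b → (S h ∧ b) ∧ _) (not-involutive _)))))
  where
  ∧-swap : ∀ a b c → (a ∧ b) ∧ c ≡ (a ∧ c) ∧ b
  ∧-swap true  true  c = sym (∧-identityʳ c)
  ∧-swap true  false c = ∧-comm false c
  ∧-swap false b     c = refl

-- First-return maps.
-- F permutes A, and its cycles are the cycles of f that meet A.

module FirstReturn {n} (P : PermOn n) (A : Fin n → Bool) (A⊆S : ∀ x → A x ≡ true → PermOn.S P x ≡ true) where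
  open PermOn P
  open Orbits P

  F : Fin n → Fin n
  F = firstAfter n f A

  F-spec : ∀ x → A x ≡ true → ∃ λ k → k < n × FirstHit f A x (F x) k
  F-spec x ax with period x (A⊆S x ax)
  ... | q , q<n , per = firstAfter-spec n f A x q q<n (trans (cong A per) ax)

  F-A : ∀ x → A x ≡ true → A (F x) ≡ true
  F-A x ax = proj₁ (proj₂ (proj₂ (proj₂ (F-spec x ax))))

  F-orb : ∀ x → A x ≡ true → Orb f x (F x)
  F-orb x ax with F-spec x ax
  ... | k , _ , e , _ = suc k , sym e

  F-unique : ∀ x y k → A x ≡ true → FirstHit f A x y k → F x ≡ y
  F-unique x y k ax hit = proj₂ (FirstHit-unique f A x (F x) y _ k (proj₂ (proj₂ (F-spec x ax))) hit)

  hit-order : ∀ x y z k k' → A x ≡ true → A y ≡ true → FirstHit f A x z k → FirstHit f A y z k' → k < k' → ⊥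
  hit-order x y z k k' ax ay (ex , _) (ey , _ , earlier) k<k' with m≤n⇒∃[o]m+o≡n k<k'
  ... | d , k+d≡k' = true≢false ax (trans (cong A x≡) (earlier d d<k'))
    where
    -- f^(k+1) x = z = f^(k+1) (f^(d+1) y), so x = f^(d+1) y
    x≡ : x ≡ iter (suc d) f y
    x≡ = iter-cancel (suc k) x _ (A⊆S x ax) (iter-S (suc d) y (A⊆S y ay))
           (trans (sym ex) (trans ey (trans (cong (λ j → iter j f y) (sym (trans (+-suc (suc k) d) (cong suc k+d≡k'))))
                                            (iter-add (suc k) (suc d) f y))))
    d<k' : d < k'
    d<k' = ≤-trans (s≤s (m≤n+m d k)) (≤-reflexive k+d≡k')

  F-inj : ∀ x y → A x ≡ true → A y ≡ true → F x ≡ F y → x ≡ y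
  F-inj x y ax ay e with F-spec x ax | F-spec y ay
  ... | k , _ , hx | k' , _ , hy with <-cmp k k'
  ... | tri≈ _ refl _ = iter-cancel (suc k) x y (A⊆S x ax) (A⊆S y ay) (trans (sym (proj₁ hx)) (trans e (proj₁ hy)))
  ... | tri< k<k' _ _ = ⊥-elim (hit-order x y (F y) k k' ax ay (subst (λ z → FirstHit f A x z k) e hx) hy k<k')
  ... | tri> _ _ k'<k = ⊥-elim (hit-order y x (F x) k' k ay ax (subst (λ z → FirstHit f A y z k') (sym e) hy) hx k'<k)

  returnPerm : PermOn n
  returnPerm = record { f = F ; S = A ; pres = F-A ; inj = F-inj }

  F-Orb⇒ : ∀ x y → A x ≡ true → Orb F x y → Orb f x y
  F-Orb⇒ x y ax (k , refl) = along k
    where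
    along : ∀ k → Orb f x (iter k F x)
    along zero    = Orb-refl f x
    along (suc k) = Orb-trans f (along k) (F-orb _ (Orbits.iter-S returnPerm k x ax))

  F-Orb⇐ : ∀ x y → A x ≡ true → A y ≡ true → Orb f x y → Orb F x y
  F-Orb⇐ x y ax ay (m , e) = go (suc m) m x ≤-refl ax e
    where
    go : ∀ b m x → m < b → A x ≡ true → iter m f x ≡ y → Orb F x y
    go (suc b) zero    x _         ax e = 0 , e
    go (suc b) (suc m) x (s≤s m<b) ax e with F-spec x ax
    ... | k , _ , ex , _ , earlier with m <? k
    ...   | yes m<k = ⊥-elim (true≢false ay (trans (cong A (sym e)) (earlier m m<k)))
    ...   | no m≮k with m≤n⇒∃[o]m+o≡n (≮⇒≥ m≮k)
    ...     | d , k+d≡m = Orb-trans F (Orb-step F x) (go b d (F x) d<b (F-A x ax) rest)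
      where
      d<b : d < b
      d<b = ≤-<-trans (subst (d ≤_) k+d≡m (m≤n+m d k)) m<b
      rest : iter d f (F x) ≡ y
      rest = trans (cong (iter d f) ex) (trans (sym (iter-add d (suc k) f x))
               (trans (cong (λ j → iter j f x) (trans (+-suc d k) (cong suc (trans (+-comm d k) k+d≡m)))) e))

  F-cycles : cyclesOn n F A ≡ cyclesOn n f (λ x → S x ∧ meets n f A x)
  F-cycles = cycles-transfer {P₁ = returnPerm} {P₂ = restrict P (meets n f A) (meets-inv A)} record
    { φ       = λ x → x
    ; φ-S     = λ x ax → ∧-intro (A⊆S x ax) (not-false (meets-A x ax))
    ; φ-orb   = λ x y ax _ → F-Orb⇒ x y ax
    ; φ-orb⁻¹ = λ x y ax ay → F-Orb⇐ x y ax ay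
    ; φ-onto  = onto
    }
    where
    meets-A : ∀ x → A x ≡ true → avoids n f A x ≡ false
    meets-A x ax with avoids n f A x in eq
    ... | false = refl
    ... | true  = ⊥-elim (true≢false ax (avoids-spec A x (A⊆S x ax) eq x (Orb-refl f x)))
    onto : ∀ t → S t ∧ meets n f A t ≡ true → Σ (Fin n) λ x → (A x ≡ true) × Orb f x t
    onto t e with ∧-elim {S t} e
    ... | st , mt with avoids-false A t (not-true mt)
    ...   | y , o , ay = y , ay , Orb-sym t y st o

⟨$⟩ʳ-injective : ∀ {a b} (π : Permutation a b) {x y} → π ⟨$⟩ʳ x ≡ π ⟨$⟩ʳ y → x ≡ y
⟨$⟩ʳ-injective π e = trans (sym (inverseˡ π)) (trans (cong (π ⟨$⟩ˡ_) e) (inverseˡ π))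

⟨$⟩ˡ-injective : ∀ {a b} (π : Permutation a b) {x y} → π ⟨$⟩ˡ x ≡ π ⟨$⟩ˡ y → x ≡ y
⟨$⟩ˡ-injective π e = trans (sym (inverseʳ π)) (trans (cong (π ⟨$⟩ʳ_) e) (inverseʳ π))

module MapFacts {D : ℕ} (M : Map D) where
  open Map M

  σPerm : PermOn nH
  σPerm = record { f = σf M ; S = λ _ → true ; pres = λ _ _ → refl ; inj = λ _ _ _ _ → ⟨$⟩ʳ-injective σ }

  α-inj : ∀ x y → α x ≡ α y → x ≡ y
  α-inj x y e = trans (sym (α-inv x)) (trans (cong α e) (α-inv y))

  cilium-fixed : ∀ h → isCilium M h ≡ true → α h ≡ h
  cilium-fixed h = ⌊⌋-true (α h ≟F h)

  nonCilium-moved : ∀ h → isCilium M h ≡ false → ¬ (α h ≡ h)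
  nonCilium-moved h e fixed = true≢false (⌊⌋-yes (α h ≟F h) fixed) e

  isCilium-α : ∀ h → isCilium M (α h) ≡ isCilium M h
  isCilium-α h = bool-ext (λ e → ⌊⌋-yes (α h ≟F h) (trans (sym (cilium-fixed (α h) e)) (α-inv h)))
                          (λ e → ⌊⌋-yes (α (α h) ≟F α h) (cong α (cilium-fixed h e)))

  inSub-α : ∀ i h → inSub M i (α h) ≡ inSub M i h
  inSub-α i h rewrite isCilium-α h | col-α h = refl

  vert-orb : ∀ x y → Orb (σf M) x y → vert x ≡ vert y
  vert-orb x y (k , refl) = sym (vert-iterate k)
    where
    vert-iterate : ∀ k → vert (iter k (σf M) x) ≡ vert x
    vert-iterate zero    = refl
    vert-iterate (suc k) = trans (vert-σ _) (vert-iterate k)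

  module Rotation (i : Fin D) = FirstReturn σPerm (inSub M i) (λ _ _ → refl)

  σSub-spec : ∀ i x → inSub M i x ≡ true → ∃ λ k → k < nH × FirstHit (σf M) (inSub M i) x (σSub M i x) k
  σSub-spec i = Rotation.F-spec i

  σSub-inSub : ∀ i x → inSub M i x ≡ true → inSub M i (σSub M i x) ≡ true
  σSub-inSub i = Rotation.F-A i

  σSub-vert : ∀ i x → inSub M i x ≡ true → vert (σSub M i x) ≡ vert x
  σSub-vert i x sx = sym (vert-orb _ _ (Rotation.F-orb i x sx))

  -- at most one cilium per vertex: a cilium followed by a cilium is fixed by σ⁽ⁱ⁾
  σSub-cilium : ∀ i c → isCilium M c ≡ true → isCilium M (σSub M i c) ≡ true → σSub M i c ≡ c
  σSub-cilium i c cc cσ = cilium-unique _ _ (cilium-fixed _ cσ) (cilium-fixed c cc) (σSub-vert i c (cilium-inSub cc))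
    where
    cilium-inSub : isCilium M c ≡ true → inSub M i c ≡ true
    cilium-inSub e rewrite e = refl

  facePerm : Fin D → PermOn nH
  facePerm i = record
    { f    = faceStep M i
    ; S    = inSub M i
    ; pres = λ x sx → trans (inSub-α i _) (σSub-inSub i x sx)
    ; inj  = λ x y sx sy e → Rotation.F-inj i x y sx sy (α-inj _ _ e)
    }

  -- α pairs the darts that are not cilia, so there are twice as many as edges
  nonCilia-twice-edges : count nH (λ h → not (isCilium M h)) ≡ 2 * nEdges M
  nonCilia-twice-edges =
    trans (count-split nH NC first) (trans (cong (nEdges M +_) (sym swapped)) (cong (nEdges M +_) (sym (+-identityʳ _))))
    where
    NC : Fin nH → Bool
    NC h = not (isCilium M h)
    first : Fin nH → Bool
    first h = ⌊ toℕ h <? toℕ (α h) ⌋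
    NC-α : ∀ h → NC (α h) ≡ NC h
    NC-α h = cong not (isCilium-α h)
    α-first : ∀ h → NC h ∧ first h ≡ true → NC (α h) ∧ not (first (α h)) ≡ true
    α-first h p with ∧-elim {NC h} p
    ... | nc , h<αh = ∧-intro {NC (α h)} (trans (NC-α h) nc) (not-false (⌊⌋-no (_ <? _)
                        (λ l → <-asym (⌊⌋-true (_ <? _) h<αh) (subst (λ w → toℕ (α h) < toℕ w) (α-inv h) l))))
    α-second : ∀ h → NC h ∧ not (first h) ≡ true → NC (α h) ∧ first (α h) ≡ true
    α-second h p with ∧-elim {NC h} p
    ... | nc , h≮αh = ∧-intro {NC (α h)} (trans (NC-α h) nc) (⌊⌋-yes (_ <? _)
                        (subst (λ w → toℕ (α h) < toℕ w) (sym (α-inv h))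
                          (≤∧≢⇒< (≮⇒≥ (λ l → true≢false (⌊⌋-yes (_ <? _) l) (not-true h≮αh)))
                                 (λ e → nonCilium-moved h (not-true nc) (toℕ-injective e)))))
    swapped : count nH (λ h → NC h ∧ first h) ≡ count nH (λ h → NC h ∧ not (first h))
    swapped = count-bij nH nH _ _ (λ h _ → α h) α-first (λ x y _ _ → α-inj x y)
                                  (λ h _ → α h) α-second (λ x y _ _ → α-inj x y)

module Removal {D : ℕ} (Mp M₀ : Map D) (R : RemovesCilia Mp M₀) where
  private
    module P  = Map Mp
    module Z  = Map M₀
    module LP = MapFacts Mp
    module L0 = MapFacts M₀
  open RemovesCilia R

  M₀-noCilium : ∀ e → isCilium M₀ e ≡ false
  M₀-noCilium e = ⌊⌋-no (Z.α e ≟F e) (noCilia e)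

  ι-noCilium : ∀ e → isCilium Mp (ι e) ≡ false
  ι-noCilium e = ⌊⌋-no (P.α (ι e) ≟F ι e) (ι-nonCil e)

  NC : Fin P.nH → Bool
  NC h = not (isCilium Mp h)

  -- both edge counts are half the number of non-cilium darts, which ι matches
  edges-preserved : nEdges Mp ≡ nEdges M₀
  edges-preserved = *-cancelˡ-≡ _ _ 2 (trans (sym LP.nonCilia-twice-edges) (trans ι-bij L0.nonCilia-twice-edges))
    where
    preimage : ∀ h → NC h ≡ true → ∃ λ e → ι e ≡ h
    preimage h nc = ι-onto h (LP.nonCilium-moved h (not-true nc))
    ι-bij : count P.nH NC ≡ count Z.nH (λ e → not (isCilium M₀ e))
    ι-bij = count-bij P.nH Z.nH _ _
      (λ h nc → proj₁ (preimage h nc)) (λ _ _ → not-false (M₀-noCilium _))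
      (λ x y p q e → trans (sym (proj₂ (preimage x p))) (trans (cong ι e) (proj₂ (preimage y q))))
      (λ e _ → ι e) (λ e _ → not-false (ι-noCilium e)) (λ x y _ _ → ι-inj x y)

  σ-skip : ∀ e → ∃ λ k → FirstHit (σf Mp) NC (ι e) (ι (σf M₀ e)) k
  σ-skip e with FirstReturn.F-spec LP.σPerm NC (λ _ _ → refl) (ι e) (not-false (ι-noCilium e))
  ... | k , _ , hit = k , subst (λ w → FirstHit (σf Mp) NC (ι e) w k) (sym (ι-σ e)) hit

  module Color (i : Fin D) where
    S : Fin P.nH → Bool
    S = inSub Mp i

    A : Fin P.nH → Bool
    A h = S h ∧ NC h

    S₀ : Fin Z.nH → Bool
    S₀ = inSub M₀ i

    fp : Fin P.nH → Fin P.nH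
    fp = faceStep Mp i

    A⊆S : ∀ z → A z ≡ true → S z ≡ true
    A⊆S z e = proj₁ (∧-elim {S z} e)

    A⊆NC : ∀ z → A z ≡ true → NC z ≡ true
    A⊆NC z e = proj₂ (∧-elim {S z} e)

    cilium-S : ∀ z → isCilium Mp z ≡ true → S z ≡ true
    cilium-S z c rewrite c = refl

    cilium-notA : ∀ z → isCilium Mp z ≡ true → A z ≡ false
    cilium-notA z c rewrite c = refl

    A-intro : ∀ z → S z ≡ true → isCilium Mp z ≡ false → A z ≡ true
    A-intro z s c = ∧-intro s (not-false c)

    S-notA-cilium : ∀ z → S z ≡ true → A z ≡ false → isCilium Mp z ≡ true
    S-notA-cilium z sz az = not≡false (∧-false sz az)

    ι-A : ∀ e → A (ι e) ≡ S₀ e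
    ι-A e rewrite ι-noCilium e | M₀-noCilium e | ι-col e = ∧-identityʳ _

    A-α : ∀ z → A (P.α z) ≡ A z
    A-α z rewrite LP.inSub-α i z | LP.isCilium-α z = refl

    ι-firstHit : ∀ k e y → FirstHit (σf M₀) S₀ e y k → ∃ λ k' → FirstHit (σf Mp) A (ι e) (ι y) k'
    ι-firstHit zero e y (ey , py , _) with σ-skip e
    ... | k₀ , hit = k₀ , FirstHit-weaken (σf Mp) NC A _ _ k₀ A⊆NC (trans (ι-A y) py)
                            (subst (λ w → FirstHit (σf Mp) NC (ι e) (ι w) k₀) (sym ey) hit)
    ι-firstHit (suc k) e y hit with FirstHit-shift (σf M₀) S₀ e y k hit
    ... | hit' , miss with ι-firstHit k (σf M₀ e) y hit' | σ-skip e
    ...   | k' , hitA | k₀ , (e₀ , _ , before) =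
            k' + suc k₀ , FirstHit-glue (σf Mp) A (ι e) _ (ι y) k₀ k' e₀
                            (λ j lt → ⊆-false NC A A⊆NC _ (before j lt)) (trans (ι-A _) miss) hitA

    module ReturnA = FirstReturn LP.σPerm A (λ _ _ → refl)
    module FaceA   = FirstReturn (LP.facePerm i) A A⊆S

    ι-σSub : ∀ e → S₀ e ≡ true → ι (σSub M₀ i e) ≡ ReturnA.F (ι e)
    ι-σSub e se with L0.σSub-spec i e se
    ... | k , _ , hit with ι-firstHit k e _ hit
    ...   | k' , hitA = sym (ReturnA.F-unique (ι e) _ k' (trans (ι-A e) se) hitA)

    -- On A, the first return of the faces of Mₚ is α after σ restricted to A:
    -- when σ⁽ⁱ⁾ leads from x to the cilium c, the face walk goes x ↦ c ↦ α σ⁽ⁱ⁾ c.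
    face-return : ∀ x → A x ≡ true → FaceA.F x ≡ P.α (ReturnA.F x)
    face-return x ax with LP.σSub-spec i x (A⊆S x ax) | isCilium Mp (σSub Mp i x) in cσ
    ... | k , _ , hitS | false =
          trans (FaceA.F-unique x _ 0 ax (refl , trans (A-α _) a-next , λ _ ()))
                (cong P.α (sym (ReturnA.F-unique x _ k ax (FirstHit-weaken (σf Mp) S A x _ k A⊆S a-next hitS))))
      where
      a-next : A (σSub Mp i x) ≡ true
      a-next = A-intro _ (proj₁ (proj₂ hitS)) cσ
    ... | k , _ , hitS | true =
          trans (FaceA.F-unique x _ 1 ax (cong (λ w → P.α (σSub Mp i w)) (sym αc) , trans (A-α _) a-y₂ , before))
                (cong P.α (sym (ReturnA.F-unique x y₂ _ ax hitA)))
      where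
      c  = σSub Mp i x
      y₂ = σSub Mp i c
      αc : P.α c ≡ c
      αc = LP.cilium-fixed c cσ
      sc : S c ≡ true
      sc = proj₁ (proj₂ hitS)
      -- y₂ is no cilium, since the only cilium at this vertex is c ≠ x
      y₂-nonCilium : isCilium Mp y₂ ≡ false
      y₂-nonCilium with isCilium Mp y₂ in cy
      ... | false = refl
      ... | true  = ⊥-elim (true≢false (subst (λ w → isCilium Mp w ≡ true) c≡x cσ) (not-true (A⊆NC x ax)))
        where
        c≡x : c ≡ x
        c≡x = LP.Rotation.F-inj i c x sc (A⊆S x ax) (LP.σSub-cilium i c cσ cy)
      a-y₂ : A y₂ ≡ true
      a-y₂ = A-intro y₂ (LP.σSub-inSub i c sc) y₂-nonCilium
      before : ∀ j → j < 1 → A (iter (suc j) fp x) ≡ false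
      before zero    _ = trans (cong A αc) (cilium-notA c cσ)
      before (suc j) (s≤s ())
      hitA : FirstHit (σf Mp) A x y₂ (proj₁ (LP.σSub-spec i c sc) + suc k)
      hitA = FirstHit-glue (σf Mp) A x c y₂ k _ (proj₁ hitS)
               (λ j lt → ⊆-false S A A⊆S _ (proj₂ (proj₂ hitS) j lt)) (cilium-notA c cσ)
               (FirstHit-weaken (σf Mp) S A c y₂ _ A⊆S a-y₂ (proj₂ (proj₂ (LP.σSub-spec i c sc))))

    ι-faceStep : ∀ e → S₀ e ≡ true → ι (faceStep M₀ i e) ≡ FaceA.F (ι e)
    ι-faceStep e se =
      trans (ι-α _) (trans (cong P.α (ι-σSub e se)) (sym (face-return (ι e) (trans (ι-A e) se))))

    faces-M₀ : cyclesOn Z.nH (faceStep M₀ i) S₀ ≡ cyclesOn P.nH fp (λ x → S x ∧ meets P.nH fp A x)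
    faces-M₀ = trans (cycles-transfer {P₁ = L0.facePerm i} {P₂ = FaceA.returnPerm} match) FaceA.F-cycles
      where
      conj : ∀ k e → S₀ e ≡ true → ι (iter k (faceStep M₀ i) e) ≡ iter k FaceA.F (ι e)
      conj = iter-conj ι (faceStep M₀ i) FaceA.F (λ x → S₀ x ≡ true) (PermOn.pres (L0.facePerm i)) ι-faceStep
      match : CycleMatch (L0.facePerm i) FaceA.returnPerm
      match = record
        { φ       = ι
        ; φ-S     = λ e se → trans (ι-A e) se
        ; φ-orb   = λ { x y sx _ (k , refl) → k , sym (conj k x sx) }
        ; φ-orb⁻¹ = λ { x y sx _ (k , p) → k , ι-inj _ _ (trans (conj k x sx) p) }
        ; φ-onto  = onto
        }
        where
        onto : ∀ t → A t ≡ true → Σ (Fin Z.nH) λ x → (S₀ x ≡ true) × Orb FaceA.F (ι x) t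
        onto t at with ι-onto t (LP.nonCilium-moved t (not-true (A⊆NC t at)))
        ... | e , refl = e , trans (sym (ι-A e)) at , 0 , refl

    -- one color-(0,i) step of B^Ω on white vertices (indexed by the cilia):
    -- along the broken face of color i, or staying put if it is trivial
    boundaryStep : Fin P.nH → Fin P.nH
    boundaryStep w = if not (trivialBroken Mp i w) then brokenEnd Mp i w else w

    module FaceC = FirstReturn (LP.facePerm i) (isCilium Mp) cilium-S

    covering-cycles : cyclesOn P.nH boundaryStep (isCilium Mp)
                    ≡ cyclesOn P.nH fp (λ x → S x ∧ meets P.nH fp (isCilium Mp) x)
    covering-cycles = trans (cyclesOn-cong P.nH boundaryStep FaceC.F (isCilium Mp) agree FaceC.F-A) FaceC.F-cycles
      where
      -- brokenEnd is the first return to the cilia; a trivial broken face returns at once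
      agree : ∀ c → isCilium Mp c ≡ true → boundaryStep c ≡ FaceC.F c
      agree c cc with trivialBroken Mp i c in triv
      ... | false = refl
      ... | true  = sym (FaceC.F-unique c c 0 cc (sym (⌊⌋-true (fp c ≟F c) triv) , cc , λ _ ()))

    -- a bare cilium: a cilium without color-i half-edges at its vertex,
    -- equivalently a cilium fixed by σ⁽ⁱ⁾
    bare : Fin P.nH → Bool
    bare c = isCilium Mp c ∧ ⌊ σSub Mp i c ≟F c ⌋

    bare-intro : ∀ c → isCilium Mp c ≡ true → σSub Mp i c ≡ c → bare c ≡ true
    bare-intro c cc fixed = ∧-intro cc (⌊⌋-yes (σSub Mp i c ≟F c) fixed)

    bare-elim : ∀ c → bare c ≡ true → (isCilium Mp c ≡ true) × (σSub Mp i c ≡ c)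
    bare-elim c b with ∧-elim {isCilium Mp c} b
    ... | cc , fixed = cc , ⌊⌋-true (σSub Mp i c ≟F c) fixed

    private module FO = Orbits (LP.facePerm i)

    faces-avoiding-A : cyclesOn P.nH fp (λ x → S x ∧ avoids P.nH fp A x) ≡ count P.nH bare
    faces-avoiding-A = count-cong P.nH _ _ (λ x → bool-ext (to x) (from x))
      where
      least : Fin P.nH → Bool
      least x = allBelow P.nH (λ k → ⌊ toℕ x ≤? toℕ (iter k fp x) ⌋)
      -- x and fp x = α σ⁽ⁱ⁾ x are cilia, hence so is σ⁽ⁱ⁾ x, which is then x itself
      to : ∀ x → ((S x ∧ avoids P.nH fp A x) ∧ least x) ≡ true → bare x ≡ true
      to x e with ∧-elim {S x} (proj₁ (∧-elim {S x ∧ avoids P.nH fp A x} e))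
      ... | sx , av = bare-intro x cx (LP.σSub-cilium i x cx cσ)
        where
        cx : isCilium Mp x ≡ true
        cx = S-notA-cilium x sx (FO.avoids-spec A x sx av x (0 , refl))
        cσ : isCilium Mp (σSub Mp i x) ≡ true
        cσ = trans (sym (LP.isCilium-α _))
                   (S-notA-cilium (fp x) (PermOn.pres (LP.facePerm i) x sx) (FO.avoids-spec A x sx av (fp x) (1 , refl)))
      from : ∀ x → bare x ≡ true → ((S x ∧ avoids P.nH fp A x) ∧ least x) ≡ true
      from x b = ∧-intro {S x ∧ _} (∧-intro {S x} (cilium-S x cx) av)
                   (allBelow-intro P.nH _ (λ k _ → ⌊⌋-yes (_ ≤? _) (≤-reflexive (cong toℕ (sym (fixed k))))))
        where
        cx = proj₁ (bare-elim x b)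
        fixed : ∀ k → iter k fp x ≡ x
        fixed = iter-fix fp x (trans (cong P.α (proj₂ (bare-elim x b))) (LP.cilium-fixed x cx))
        av : avoids P.nH fp A x ≡ true
        av = FO.avoids-intro A x (λ { y (k , refl) → trans (cong A (fixed k)) (cilium-notA x cx) })

    edgeless : Fin P.nV → Bool
    edgeless = noneAt P.nH P.vert A

    isolated₀-edgeless : ∀ u → isolatedUnciliated M₀ i u ≡ edgeless (vmap ⟨$⟩ʳ u)
    isolated₀-edgeless u = bool-ext to from
      where
      to : isolatedUnciliated M₀ i u ≡ true → edgeless (vmap ⟨$⟩ʳ u) ≡ true
      to iso = noneAt-intro P.nH P.vert A _ noA
        where
        noA : ∀ h → P.vert h ≡ vmap ⟨$⟩ʳ u → A h ≡ false
        noA h vh with A h in ah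
        ... | false = refl
        ... | true with ι-onto h (LP.nonCilium-moved h (not-true (A⊆NC h ah)))
        ...   | e , refl = ⊥-elim (true≢false (trans (sym (ι-A e)) ah)
                  (noneAt-spec Z.nH Z.vert S₀ u iso e (⟨$⟩ʳ-injective vmap (trans (sym (ι-vert e)) vh))))
      from : edgeless (vmap ⟨$⟩ʳ u) ≡ true → isolatedUnciliated M₀ i u ≡ true
      from el = noneAt-intro Z.nH Z.vert S₀ u (λ e ve → trans (sym (ι-A e))
                  (noneAt-spec P.nH P.vert A _ el (ι e) (trans (ι-vert e) (cong (vmap ⟨$⟩ʳ_) ve))))

    isolated₀-count : count Z.nV (isolatedUnciliated M₀ i) ≡ count P.nV edgeless
    isolated₀-count = count-bij Z.nV P.nV _ edgeless
      (λ u _ → vmap ⟨$⟩ʳ u) (λ u p → trans (sym (isolated₀-edgeless u)) p) (λ _ _ _ _ → ⟨$⟩ʳ-injective vmap)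
      (λ v _ → vmap ⟨$⟩ˡ v) (λ v q → trans (isolated₀-edgeless _) (trans (cong edgeless (inverseʳ vmap)) q))
      (λ _ _ _ _ → ⟨$⟩ˡ-injective vmap)

    isolated⇒edgeless : ∀ v → isolatedUnciliated Mp i v ≡ true → edgeless v ≡ true
    isolated⇒edgeless v iso =
      noneAt-intro P.nH P.vert A v (λ h vh → ⊆-false S A A⊆S h (noneAt-spec P.nH P.vert S v iso h vh))

    edgeless-bare : ∀ v → edgeless v ≡ true → isolatedUnciliated Mp i v ≡ false →
      Σ (Fin P.nH) λ c → (P.vert c ≡ v) × (bare c ≡ true)
    edgeless-bare v el notIso with noneAt-witness P.nH P.vert S v notIso
    ... | x , vx , sx = x , vx , bare-intro x cx (LP.σSub-cilium i x cx cσ)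
      where
      cx : isCilium Mp x ≡ true
      cx = S-notA-cilium x sx (noneAt-spec P.nH P.vert A v el x vx)
      cσ : isCilium Mp (σSub Mp i x) ≡ true
      cσ = S-notA-cilium _ (LP.σSub-inSub i x sx)
             (noneAt-spec P.nH P.vert A v el _ (trans (LP.σSub-vert i x sx) vx))

    bare-edgeless : ∀ c → bare c ≡ true → (edgeless (P.vert c) ≡ true) × (isolatedUnciliated Mp i (P.vert c) ≡ false)
    bare-edgeless c b = noneAt-intro P.nH P.vert A (P.vert c) noA , notIso
      where
      cc    = proj₁ (bare-elim c b)
      fixed = proj₂ (bare-elim c b)
      -- a genuine half-edge at this vertex would lie on the σ⁽ⁱ⁾-cycle of c, which is {c}
      noA : ∀ a → P.vert a ≡ P.vert c → A a ≡ false
      noA a va with A a in aa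
      ... | false = refl
      ... | true with LP.Rotation.F-Orb⇐ i c a (cilium-S c cc) (A⊆S a aa) (P.vert-cycle c a (sym va))
      ...   | k , p = ⊥-elim (true≢false aa
                        (subst (λ w → A w ≡ false) (trans (sym (iter-fix (σSub Mp i) c fixed k)) p) (cilium-notA c cc)))
      notIso : isolatedUnciliated Mp i (P.vert c) ≡ false
      notIso with isolatedUnciliated Mp i (P.vert c) in iso
      ... | false = refl
      ... | true  = ⊥-elim (true≢false (cilium-S c cc) (noneAt-spec P.nH P.vert S (P.vert c) iso c refl))

    edgeless-split : count P.nV edgeless ≡ count P.nV (isolatedUnciliated Mp i) + count P.nH bare
    edgeless-split = trans (count-split P.nV edgeless (isolatedUnciliated Mp i)) (cong₂ _+_ isolated bareVertices)
      where
      isolated : count P.nV (λ v → edgeless v ∧ isolatedUnciliated Mp i v) ≡ count P.nV (isolatedUnciliated Mp i)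
      isolated = count-cong P.nV _ _ (λ v → bool-ext (λ e → proj₂ (∧-elim {edgeless v} e))
                                                     (λ e → ∧-intro (isolated⇒edgeless v e) e))
      bareVertices : count P.nV (λ v → edgeless v ∧ not (isolatedUnciliated Mp i v)) ≡ count P.nH bare
      bareVertices = count-bij P.nV P.nH _ bare
        (λ v p → proj₁ (witness v p)) (λ v p → proj₂ (proj₂ (witness v p)))
        (λ v w p q e → trans (sym (proj₁ (proj₂ (witness v p)))) (trans (cong P.vert e) (proj₁ (proj₂ (witness w q)))))
        (λ c _ → P.vert c) (λ c b → let (el , ni) = bare-edgeless c b in ∧-intro {edgeless _} el (not-false ni))
        (λ c c' b b' → P.cilium-unique c c' (LP.cilium-fixed c (proj₁ (bare-elim c b))) (LP.cilium-fixed c' (proj₁ (bare-elim c' b'))))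
        where
        witness : ∀ v → edgeless v ∧ not (isolatedUnciliated Mp i v) ≡ true → Σ (Fin P.nH) λ c → (P.vert c ≡ v) × (bare c ≡ true)
        witness v p with ∧-elim {edgeless v} p
        ... | el , ni = edgeless-bare v el (not-true ni)

    closedFaces-Mp : closedFaces Mp i
                   ≡ cyclesOn P.nH fp (λ x → S x ∧ avoids P.nH fp (isCilium Mp) x) + count P.nV (isolatedUnciliated Mp i)
    closedFaces-Mp = cong (_+ count P.nV (isolatedUnciliated Mp i)) (count-cong P.nH _ _ (λ h → sym (∧-assoc (S h) _ _)))

    -- M₀ has no cilia, so all its face cycles are closed faces
    closedFaces-M₀ : closedFaces M₀ i ≡ cyclesOn Z.nH (faceStep M₀ i) S₀ + count Z.nV (isolatedUnciliated M₀ i)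
    closedFaces-M₀ = cong (_+ count Z.nV (isolatedUnciliated M₀ i)) (count-cong Z.nH _ _ noCiliaMet)
      where
      noCiliaMet : ∀ h → (S₀ h ∧ allBelow Z.nH (λ k → not (isCilium M₀ (iter k (faceStep M₀ i) h)))
                                ∧ allBelow Z.nH (λ k → ⌊ toℕ h ≤? toℕ (iter k (faceStep M₀ i) h) ⌋))
                       ≡ (S₀ h ∧ allBelow Z.nH (λ k → ⌊ toℕ h ≤? toℕ (iter k (faceStep M₀ i) h) ⌋))
      noCiliaMet h rewrite allBelow-intro Z.nH (λ k → not (isCilium M₀ (iter k (faceStep M₀ i) h)))
                                                (λ k _ → not-false (M₀-noCilium _)) = refl

    color-faces : closedFaces Mp i + cyclesOn P.nH boundaryStep (isCilium Mp) ≡ closedFaces M₀ i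
    color-faces = begin
        closedFaces Mp i + cyclesOn P.nH boundaryStep (isCilium Mp)
      ≡⟨ cong₂ _+_ closedFaces-Mp covering-cycles ⟩
        (avoidC + isoP) + meetC
      ≡⟨ xy∙z≈zx∙y avoidC isoP meetC ⟩
        (meetC + avoidC) + isoP
      ≡⟨ cong (_+ isoP) (trans (sym (cycles-split P.nH fp S (isCilium Mp))) (cycles-split P.nH fp S A)) ⟩
        (meetA + avoidA) + isoP
      ≡⟨ cong (_+ isoP) (cong₂ _+_ (sym faces-M₀) faces-avoiding-A) ⟩
        (faces₀ + count P.nH bare) + isoP
      ≡⟨ xy∙z≈x∙zy faces₀ (count P.nH bare) isoP ⟩
        faces₀ + (isoP + count P.nH bare)
      ≡⟨ cong (faces₀ +_) (sym (trans isolated₀-count edgeless-split)) ⟩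
        faces₀ + count Z.nV (isolatedUnciliated M₀ i)
      ≡⟨ sym closedFaces-M₀ ⟩
        closedFaces M₀ i
      ∎
      where
      open ≡-Reasoning
      avoidC = cyclesOn P.nH fp (λ x → S x ∧ avoids P.nH fp (isCilium Mp) x)
      meetC  = cyclesOn P.nH fp (λ x → S x ∧ meets P.nH fp (isCilium Mp) x)
      avoidA = cyclesOn P.nH fp (λ x → S x ∧ avoids P.nH fp A x)
      meetA  = cyclesOn P.nH fp (λ x → S x ∧ meets P.nH fp A x)
      isoP   = count P.nV (isolatedUnciliated Mp i)
      faces₀ = cyclesOn Z.nH (faceStep M₀ i) S₀

  faces-removed : nFaces M₀ ≡ nFaces Mp + coveringFaces (covering (boundary Mp) (inducedPairing (boundary Mp))
                                                                     (inducedPairing (boundary Mp)))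
  faces-removed = trans (sumF-cong D _ _ (λ i → sym (Color.color-faces i))) (sumF-+ D _ _)

-- The theorem.  Integers enter only here: their prefix +_ would clash
-- with the sections (n +_) used above.

open import Data.Integer using (ℤ; +_; _-_)
import Data.Integer as ℤ
open import Data.Integer.Properties using (pos-+)
open import Data.Integer.Solver using (module +-*-Solver)

add-subtract : ∀ (a c x : ℤ) → a - x ≡ ((a ℤ.+ c) - x) - c
add-subtract = solve 3 (λ a c x → a :- x := ((a :+ c) :- x) :- c) refl
  where open +-*-Solver

lemma4 : ∀ {D : ℕ} → 2 ≤ D → (Mp M₀ : Map D) → RemovesCilia Mp M₀ →
    δ Mp ≡ δ M₀ - + coveringFaces (covering (boundary Mp) (inducedPairing (boundary Mp)) (inducedPairing (boundary Mp)))
lemma4 {D} _ Mp M₀ R = begin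
    + nFaces Mp - + ((D ∸ 1) * nEdges Mp)
  ≡⟨ add-subtract (+ nFaces Mp) (+ cov) (+ ((D ∸ 1) * nEdges Mp)) ⟩
    ((+ nFaces Mp ℤ.+ + cov) - + ((D ∸ 1) * nEdges Mp)) - + cov
  ≡⟨ cong₂ (λ F E → (F - + ((D ∸ 1) * E)) - + cov)
           (trans (sym (pos-+ (nFaces Mp) cov)) (cong +_ (sym faces-removed))) edges-preserved ⟩
    (+ nFaces M₀ - + ((D ∸ 1) * nEdges M₀)) - + cov
  ∎
  where
  open ≡-Reasoning
  open Removal Mp M₀ R
  cov = coveringFaces (covering (boundary Mp) (inducedPairing (boundary Mp)) (inducedPairing (boundary Mp)))
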